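{- Let $t\ge 1$ and $2\le \ell\le 4$ be integers. Then $\chi_p(P_{\ell t}\Diamond_\ell K_4)\le 4$ if $t=1$, $\chi_p(P_{\ell t}\Diamond_\ell K_4)\le 6$ if $t\in\{2,3\}$, and $\chi_p(P_{\ell t}\Diamond_\ell K_4)\le 8$ if $t\ge 4$. Moreover, equality holds for $t\in\{1,2,3\}$.
   Context: A packing $k$-coloring of a graph $H$ is a map $c:V(H)\to\{1,\ldots,k\}$ such that any two distinct vertices $u,v$ with $c(u)=c(v)=i$ satisfy $d_H(u,v)\ge i+1$. The packing chromatic number $\chi_p(H)$ is the least such $k$. $P_m$ denotes the path $v_1\cdots v_m$ and $K_n$ the complete graph on $n$ vertices. Path-aligned product: for positive integers $\ell\mid m$ and a connected vertex-transitive graph $G$ containing $P_\ell$ as a subgraph, $P_m\Diamond_\ell G$ is formed from the path $P_m=v_1\cdots v_m$ and $m/\ell$ pairwise disjoint copies of $G$, where for each $1\le i\le m/\ell$ the consecutive path vertices $v_{(i-1)\ell+1},\ldots,v_{i\ell}$ are identified, in order, with $\ell$ distinct vertices of the $i$-th copy of $G=K_n$. Consecutive copies are joined only by the path edges $v_{i\ell}v_{i\ell+1}$. -}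

module Defs where

open import Level using (0ℓ)
open import Data.Nat using (ℕ; zero; suc; _≤_; _<_; _∸_)
open import Data.Fin using (Fin; toℕ)
open import Data.Product using (_×_; Σ; _,_)
open import Data.Sum using (_⊎_)
open import Relation.Nullary using (¬_)
open import Relation.Binary.PropositionalEquality using (_≡_; _≢_)

record Graph : Set₁ where
  field
    V   : Set
    Adj : V → V → Set
open Graph public

-- Within H u v k : there is a walk from u to v of length at most k,
-- i.e. d_H(u,v) ≤ k.
data Within (H : Graph) : V H → V H → ℕ → Set where
  here : ∀ {u k} → Within H u u k
  step : ∀ {u w v k} → Adj H u w → Within H w v k → Within H u v (suc k)

record PackingColoring (H : Graph) (k : ℕ) : Set where
  field
    col     : V H → ℕ
    col-pos : ∀ v → 1 ≤ col v
    col-≤k  : ∀ v → col v ≤ k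
    packing : ∀ u v → u ≢ v → col u ≡ col v → ¬ Within H u v (col u)

PackingColorable : Graph → ℕ → Set
PackingColorable H k = PackingColoring H k

χp≡ : Graph → ℕ → Set
χp≡ H k = PackingColorable H k × (∀ j → j < k → ¬ PackingColorable H j)

-- P_{ℓt} ◇_ℓ K₄ : t copies of K₄, vertex (i , a) is vertex a of copy i.
-- Path vertex v_{iℓ + a + 1} (0 ≤ a < ℓ) is vertex a of copy i (0-indexed).
-- Edges: all pairs inside a copy (K₄; this contains the path edges inside
-- a copy), plus the path edge joining vertex ℓ-1 of copy i to vertex 0 of
-- copy i+1 (in both directions).
PathK4Adj : (t ℓ : ℕ) → Fin t × Fin 4 → Fin t × Fin 4 → Set
PathK4Adj t ℓ (i , a) (j , b) =
    (i ≡ j × a ≢ b)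
  ⊎ (toℕ j ≡ suc (toℕ i) × toℕ a ≡ ℓ ∸ 1 × toℕ b ≡ 0)
  ⊎ (toℕ i ≡ suc (toℕ j) × toℕ b ≡ ℓ ∸ 1 × toℕ a ≡ 0)

PathK4 : (t ℓ : ℕ) → Graph
PathK4 t ℓ = record { V = Fin t × Fin 4 ; Adj = PathK4Adj t ℓ }

{-# OPTIONS --safe #-}
module Submission where

-- Upper bounds: copy i is coloured by row (i mod 4) of a fixed 4 × 4 template.
-- A walk from vertex a of copy i to vertex b of a later copy j must leave each
-- copy through its exit vertex and enter the next one at vertex 0, so it has
-- length at least 2(j − i) − [a is the exit] + [b is not the entry].  This
-- exceeds 8 once j − i ≥ 5, so validity of the colouring reduces to a finite
-- check on the template.  The first one, two and three copies only use colours up to 4, 6, 6.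
-- Lower bounds: a copy of K₄ needs four distinct colours.  Any two vertices of
-- two consecutive copies are within distance 3, so among these eight vertices
-- colours 1 and 2 occur at most twice each and any other colour at most once;
-- with at most five colours that accounts for only seven vertices.

open import Defs
open import Data.Bool using (true; false; if_then_else_)
open import Data.Fin using (Fin; zero; suc; toℕ; fromℕ<; _↑ˡ_; remQuot; combine)
open import Data.Fin.Patterns using (0F; 1F; 2F; 3F; 4F; 5F; 6F)
open import Data.Fin.Properties
  using (all?; toℕ-injective; toℕ-fromℕ<; injective⇒≤; ↑ˡ-injective; combine-remQuot)
  renaming (_≟_ to _≟ᶠ_)
open import Data.Nat using (ℕ; zero; suc; _+_; _*_; _∸_; _≤_; _<_; z≤n; s≤s; s≤s⁻¹; _≟_; _≤?_; _<?_)
open import Data.Nat.Properties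
open import Data.Product using (_×_; _,_; proj₁; proj₂; ∃; uncurry)
open import Data.Product.Properties using (,-injective; ≡-dec)
open import Data.Sum using (_⊎_; inj₁; inj₂; [_,_]′)
open import Data.Vec using (Vec; []; _∷_; lookup)
open import Function using (_∘_)
open import Relation.Binary using (tri<; tri≈; tri>)
open import Relation.Binary.PropositionalEquality
  using (_≡_; _≢_; refl; sym; trans; cong; cong₂; subst; module ≡-Reasoning)
open import Relation.Nullary using (¬_; Dec; yes; no; does)
open import Relation.Nullary.Decidable
  using (from-yes; dec-true; map′; decidable-stable; _×-dec_; _⊎-dec_; _→-dec_)

module _ {H : Graph} where

  Within-weaken : ∀ {u v m n} → Within H u v m → m ≤ n → Within H u v n
  Within-weaken here          _         = here
  Within-weaken (step uw wv) (s≤s m≤n) = step uw (Within-weaken wv m≤n)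

  Within-++ : ∀ {u w v m n} → Within H u w m → Within H w v n → Within H u v (m + n)
  Within-++ {m = m} {n} here wv = Within-weaken wv (m≤n+m n m)
  Within-++ (step uu′ u′w) wv   = step uu′ (Within-++ u′w wv)

  Within-snoc : ∀ {u w v k} → Within H u w k → Adj H w v → Within H u v (suc k)
  Within-snoc here         wv = step wv here
  Within-snoc (step uu′ w) wv = step uu′ (Within-snoc w wv)

  Within-reverse : (∀ {u v} → Adj H u v → Adj H v u) →
                   ∀ {u v k} → Within H u v k → Within H v u k
  Within-reverse adj-sym here        = here
  Within-reverse adj-sym (step uw w) = Within-snoc (Within-reverse adj-sym w) (adj-sym uw)

  potential-≤-length : (f g : V H → ℕ) →
                       (∀ {u w} → Adj H u w → f w ≤ suc (f u)) →
                       (∀ {u w} → Adj H u w → g w ≤ suc (f u)) →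
                       ∀ {u v k} → Within H u v k → u ≡ v ⊎ g v ≤ k + f u
  potential-≤-length f g f-step g-step here = inj₁ refl
  potential-≤-length f g f-step g-step {u} (step {k = k} uw wv)
    with potential-≤-length f g f-step g-step wv
  ... | inj₁ refl = inj₂ (≤-trans (g-step uw) (s≤s (m≤n+m (f u) k)))
  ... | inj₂ gv≤  = inj₂ (≤-trans gv≤ (≤-trans (+-monoʳ-≤ k (f-step uw)) (≤-reflexive (+-suc k (f u)))))

module _ {H : Graph} {k : ℕ} (K : PackingColoring H k) where
  open PackingColoring K

  colour-clash : ∀ {u v n} → u ≢ v → Within H u v n → n ≤ col u → col u ≢ col v
  colour-clash u≢v w n≤c same = packing _ _ u≢v same (Within-weaken w n≤c)

  colourIndex : ∀ {n} → k ≤ n → V H → Fin n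
  colourIndex k≤n v = fromℕ< (∸-monoˡ-< (s≤s (≤-trans (col-≤k v) k≤n)) (col-pos v))

  suc-colourIndex : ∀ {n} (k≤n : k ≤ n) v → suc (toℕ (colourIndex k≤n v)) ≡ col v
  suc-colourIndex k≤n v = begin
    suc (toℕ (colourIndex k≤n v)) ≡⟨ cong suc (toℕ-fromℕ< _) ⟩
    suc (col v ∸ 1)               ≡⟨ +-∸-assoc 1 (col-pos v) ⟨
    col v                         ∎
    where open ≡-Reasoning

  colourIndex-injective : ∀ {n} (k≤n : k ≤ n) {u v} →
                          colourIndex k≤n u ≡ colourIndex k≤n v → col u ≡ col v
  colourIndex-injective k≤n {u} {v} same =
    trans (sym (suc-colourIndex k≤n u)) (trans (cong (suc ∘ toℕ) same) (suc-colourIndex k≤n v))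

module _ {t ℓ : ℕ} where

  PathK4-sym : ∀ {u v} → PathK4Adj t ℓ u v → PathK4Adj t ℓ v u
  PathK4-sym (inj₁ (refl , a≢b))   = inj₁ (refl , a≢b ∘ sym)
  PathK4-sym (inj₂ (inj₁ forward)) = inj₂ (inj₂ forward)
  PathK4-sym (inj₂ (inj₂ back))    = inj₂ (inj₁ back)

  within-copy : ∀ i a b → Within (PathK4 t ℓ) (i , a) (i , b) 1
  within-copy i a b with a ≟ᶠ b
  ... | yes refl = here
  ... | no a≢b   = step (inj₁ (refl , a≢b)) here

atExit : ℕ → Fin 4 → ℕ
atExit ℓ a = if does (toℕ a ≟ ℓ ∸ 1) then 1 else 0

atExit≤1 : ∀ ℓ a → atExit ℓ a ≤ 1
atExit≤1 ℓ a with does (toℕ a ≟ ℓ ∸ 1)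
... | true  = ≤-refl
... | false = z≤n

atExit-exit : ∀ {ℓ} a → toℕ a ≡ ℓ ∸ 1 → atExit ℓ a ≡ 1
atExit-exit {ℓ} a a≡exit rewrite dec-true (toℕ a ≟ ℓ ∸ 1) a≡exit = refl

offEntry : Fin 4 → ℕ
offEntry zero    = 0
offEntry (suc _) = 1

offEntry≤1 : ∀ a → offEntry a ≤ 1
offEntry≤1 zero    = z≤n
offEntry≤1 (suc _) = ≤-refl

-- For copies i < j the distance from (i , a) to (j , b) is exactly
-- arrival (j , b) ∸ departure ℓ (i , a).
departure : ∀ {t} → ℕ → Fin t × Fin 4 → ℕ
departure ℓ (i , a) = atExit ℓ a + 2 * toℕ i

arrival : ∀ {t} → Fin t × Fin 4 → ℕ
arrival (j , b) = offEntry b + 2 * toℕ j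

module _ {t ℓ : ℕ} where

  forward-bridge-≡ : ∀ {i j : Fin t} {a} → toℕ j ≡ suc (toℕ i) → toℕ a ≡ ℓ ∸ 1 →
                     2 * toℕ j ≡ suc (departure ℓ (i , a))
  forward-bridge-≡ {i} {j} {a} j≡1+i a≡exit = begin
    2 * toℕ j                    ≡⟨ cong (2 *_) j≡1+i ⟩
    2 * suc (toℕ i)              ≡⟨ *-suc 2 (toℕ i) ⟩
    suc (1 + 2 * toℕ i)          ≡⟨ cong (λ x → suc (x + 2 * toℕ i)) (atExit-exit {ℓ} a a≡exit) ⟨
    suc (atExit ℓ a + 2 * toℕ i) ∎
    where open ≡-Reasoning

  backward-bridge-≤ : ∀ {i j : Fin t} {x} y → toℕ i ≡ suc (toℕ j) → x ≤ 1 →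
                      x + 2 * toℕ j ≤ suc (y + 2 * toℕ i)
  backward-bridge-≤ {i} {j} {x} y i≡1+j x≤1 = begin
    x + 2 * toℕ j       ≤⟨ +-monoˡ-≤ (2 * toℕ j) x≤1 ⟩
    suc (2 * toℕ j)     ≤⟨ n≤1+n (suc (2 * toℕ j)) ⟩
    2 + 2 * toℕ j       ≡⟨ *-suc 2 (toℕ j) ⟨
    2 * suc (toℕ j)     ≡⟨ cong (2 *_) i≡1+j ⟨
    2 * toℕ i           ≤⟨ m≤n+m _ y ⟩
    y + 2 * toℕ i       ≤⟨ n≤1+n (y + 2 * toℕ i) ⟩
    suc (y + 2 * toℕ i) ∎
    where open ≤-Reasoning

  departure-step : 2 ≤ ℓ → ∀ {u w} → PathK4Adj t ℓ u w → departure ℓ w ≤ suc (departure ℓ u)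
  departure-step _ {i , a} {_ , b} (inj₁ (refl , _)) =
    +-monoˡ-≤ (2 * toℕ i) (≤-trans (atExit≤1 ℓ b) (s≤s (z≤n {atExit ℓ a})))
  departure-step (s≤s (s≤s _)) {_ , _} {_ , zero} (inj₂ (inj₁ (j≡1+i , a≡exit , _))) =
    ≤-reflexive (forward-bridge-≡ j≡1+i a≡exit)
  departure-step _ {_ , zero} {_ , b} (inj₂ (inj₂ (i≡1+j , _ , _))) =
    backward-bridge-≤ (atExit ℓ zero) i≡1+j (atExit≤1 ℓ b)

  arrival-step : ∀ {u w} → PathK4Adj t ℓ u w → arrival w ≤ suc (departure ℓ u)
  arrival-step {i , a} {_ , b} (inj₁ (refl , _)) =
    +-monoˡ-≤ (2 * toℕ i) (≤-trans (offEntry≤1 b) (s≤s (z≤n {atExit ℓ a})))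
  arrival-step {_ , _} {_ , zero} (inj₂ (inj₁ (j≡1+i , a≡exit , _))) =
    ≤-reflexive (forward-bridge-≡ j≡1+i a≡exit)
  arrival-step {_ , zero} {_ , b} (inj₂ (inj₂ (i≡1+j , _ , _))) =
    backward-bridge-≤ (atExit ℓ zero) i≡1+j (offEntry≤1 b)

module _ {t ℓ : ℕ} (2≤ℓ : 2 ≤ ℓ) where

  arrival-≤ : ∀ {u v k} → Within (PathK4 t ℓ) u v k → u ≡ v ⊎ arrival v ≤ k + departure ℓ u
  arrival-≤ = potential-≤-length (departure ℓ) arrival (departure-step 2≤ℓ) (arrival-step {ℓ = ℓ})

  Rainbow : (Fin t × Fin 4 → ℕ) → Set
  Rainbow col = ∀ i a b → col (i , a) ≡ col (i , b) → a ≡ b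

  Spread : (Fin t × Fin 4 → ℕ) → Set
  Spread col = ∀ {i j} a b → toℕ i < toℕ j → col (i , a) ≡ col (j , b) →
               col (i , a) + departure ℓ (i , a) < arrival (j , b)

  spread⇒packing : ∀ {col} → Rainbow col → Spread col →
                   ∀ u v → u ≢ v → col u ≡ col v → ¬ Within (PathK4 t ℓ) u v (col u)
  spread⇒packing {col} rainbow spread (i , a) (j , b) u≢v same w with <-cmp (toℕ i) (toℕ j)
  ... | tri< i<j _ _ = [ u≢v , <⇒≱ (spread a b i<j same) ]′ (arrival-≤ w)
  ... | tri≈ _ i≡j _ with refl ← toℕ-injective i≡j = u≢v (cong (i ,_) (rainbow i a b same))
  ... | tri> _ _ j<i = [ u≢v ∘ sym , <⇒≱ (spread b a j<i (sym same)) ]′ (arrival-≤ back)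
    where
    back : Within (PathK4 t ℓ) (j , b) (i , a) (col (j , b))
    back = subst (Within _ _ _) same (Within-reverse (PathK4-sym {ℓ = ℓ}) w)

  spreadColouring : ∀ {k} col → (∀ v → 1 ≤ col v) → (∀ v → col v ≤ k) →
                    Rainbow col → Spread col → PackingColoring (PathK4 t ℓ) k
  spreadColouring col pos ≤k rainbow spread = record
    { col = col ; col-pos = pos ; col-≤k = ≤k ; packing = spread⇒packing rainbow spread }

next : Fin 4 → Fin 4
next 0F = 1F
next 1F = 2F
next 2F = 3F
next 3F = 0F

advance : ℕ → Fin 4 → Fin 4
advance zero    ρ = ρ
advance (suc n) ρ = next (advance n ρ)

advance-+ : ∀ m n ρ → advance (m + n) ρ ≡ advance m (advance n ρ)
advance-+ zero    n ρ = refl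
advance-+ (suc m) n ρ = cong next (advance-+ m n ρ)

phase : ℕ → Fin 4
phase n = advance n 0F

-- Colours 1 and 2 recur in every copy, 3 and 4 in every second copy and 5–8 in
-- every fourth one.  The last clause is the template for ℓ = 4; other values of
-- ℓ never use it.
rows : ℕ → Vec (Vec ℕ 4) 4
rows 2 = (1 ∷ 3 ∷ 2 ∷ 4 ∷ []) ∷ (1 ∷ 5 ∷ 2 ∷ 6 ∷ []) ∷ (1 ∷ 3 ∷ 2 ∷ 4 ∷ []) ∷ (1 ∷ 7 ∷ 2 ∷ 8 ∷ []) ∷ []
rows 3 = (1 ∷ 2 ∷ 3 ∷ 4 ∷ []) ∷ (1 ∷ 2 ∷ 5 ∷ 6 ∷ []) ∷ (1 ∷ 2 ∷ 3 ∷ 4 ∷ []) ∷ (1 ∷ 2 ∷ 7 ∷ 8 ∷ []) ∷ []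
rows _ = (1 ∷ 2 ∷ 4 ∷ 3 ∷ []) ∷ (1 ∷ 2 ∷ 5 ∷ 6 ∷ []) ∷ (1 ∷ 2 ∷ 4 ∷ 3 ∷ []) ∷ (1 ∷ 2 ∷ 8 ∷ 7 ∷ []) ∷ []

template : ℕ → Fin 4 → Fin 4 → ℕ
template ℓ ρ = lookup (lookup (rows ℓ) ρ)

rowBound : Fin 4 → ℕ
rowBound = lookup (4 ∷ 6 ∷ 4 ∷ 8 ∷ [])

rowBound≤8 : ∀ ρ → rowBound ρ ≤ 8
rowBound≤8 = from-yes (all? λ ρ → rowBound ρ ≤? 8)

record Admissible (ℓ : ℕ) : Set where
  field
    rainbow : ∀ ρ a b → template ℓ ρ a ≡ template ℓ ρ b → a ≡ b
    bounded : ∀ ρ a → 1 ≤ template ℓ ρ a × template ℓ ρ a ≤ rowBound ρ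
    spaced  : ∀ (d : Fin 4) ρ a b → template ℓ ρ a ≡ template ℓ (advance (suc (toℕ d)) ρ) b →
              template ℓ ρ a + atExit ℓ a < offEntry b + 2 * suc (toℕ d)

admissible? : ∀ ℓ → Dec (Admissible ℓ)
admissible? ℓ = map′ (λ (r , b , s) → record { rainbow = r ; bounded = b ; spaced = s })
                     (λ A → let open Admissible A in rainbow , bounded , spaced)
                     (rainbow? ×-dec bounded? ×-dec spaced?)
  where
  T = template ℓ
  rainbow? = all? λ ρ → all? λ a → all? λ b → (T ρ a ≟ T ρ b) →-dec (a ≟ᶠ b)
  bounded? = all? λ ρ → all? λ a → (1 ≤? T ρ a) ×-dec (T ρ a ≤? rowBound ρ)
  spaced?  = all? λ d → all? λ ρ → all? λ a → all? λ b →
             (T ρ a ≟ T (advance (suc (toℕ d)) ρ) b) →-dec (_ <? _)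

template-admissible : ∀ {ℓ} → 2 ≤ ℓ → ℓ ≤ 4 → Admissible ℓ
template-admissible {2} _ _ = from-yes (admissible? 2)
template-admissible {3} _ _ = from-yes (admissible? 3)
template-admissible {4} _ _ = from-yes (admissible? 4)
template-admissible {suc (suc (suc (suc (suc _))))} _ (s≤s (s≤s (s≤s (s≤s ()))))
template-admissible {1} (s≤s ()) _

<⇒suc-gap : ∀ {m n} → m < n → ∃ λ g → n ≡ suc g + m
<⇒suc-gap {m} m<n with g , refl ← m≤n⇒∃[o]m+o≡n m<n = g , cong suc (+-comm m g)

module Periodic {t ℓ : ℕ} (2≤ℓ : 2 ≤ ℓ) (A : Admissible ℓ) where
  open Admissible A

  colour : Fin t × Fin 4 → ℕ
  colour (i , a) = template ℓ (phase (toℕ i)) a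

  spaced-at : ∀ g ρ a b → template ℓ ρ a ≡ template ℓ (advance (suc g) ρ) b →
              template ℓ ρ a + atExit ℓ a < offEntry b + 2 * suc g
  spaced-at 0 = spaced 0F
  spaced-at 1 = spaced 1F
  spaced-at 2 = spaced 2F
  spaced-at 3 = spaced 3F
  spaced-at g@(suc (suc (suc (suc _)))) ρ a b _ = begin-strict
    template ℓ ρ a + atExit ℓ a ≤⟨ +-mono-≤ template≤8 (atExit≤1 ℓ a) ⟩
    9                           <⟨ *-monoʳ-≤ 2 (s≤s (s≤s (s≤s (s≤s (s≤s z≤n))))) ⟩
    2 * suc g                   ≤⟨ m≤n+m _ (offEntry b) ⟩
    offEntry b + 2 * suc g      ∎
    where
    open ≤-Reasoning
    template≤8 = ≤-trans (proj₂ (bounded ρ a)) (rowBound≤8 ρ)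

  spaced-phases : ∀ {m n} a b → m < n → template ℓ (phase m) a ≡ template ℓ (phase n) b →
                  template ℓ (phase m) a + (atExit ℓ a + 2 * m) < offEntry b + 2 * n
  spaced-phases {m} a b m<n same with g , refl ← <⇒suc-gap m<n = begin-strict
    c + (atExit ℓ a + 2 * m)         ≡⟨ +-assoc c _ _ ⟨
    c + atExit ℓ a + 2 * m           <⟨ +-monoˡ-< (2 * m) (spaced-at g (phase m) a b same′) ⟩
    offEntry b + 2 * suc g + 2 * m   ≡⟨ +-assoc (offEntry b) _ _ ⟩
    offEntry b + (2 * suc g + 2 * m) ≡⟨ cong (offEntry b +_) (*-distribˡ-+ 2 (suc g) m) ⟨
    offEntry b + 2 * (suc g + m)     ∎
    where
    open ≤-Reasoning
    c = template ℓ (phase m) a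
    same′ : c ≡ template ℓ (advance (suc g) (phase m)) b
    same′ = trans same (cong (λ ρ → template ℓ ρ b) (advance-+ (suc g) m 0F))

  packingColouring : ∀ {k} → (∀ (i : Fin t) → rowBound (phase (toℕ i)) ≤ k) →
                     PackingColoring (PathK4 t ℓ) k
  packingColouring copy≤k = spreadColouring 2≤ℓ colour
    (λ (i , a) → proj₁ (bounded (phase (toℕ i)) a))
    (λ (i , a) → ≤-trans (proj₂ (bounded (phase (toℕ i)) a)) (copy≤k i))
    (λ i → rainbow (phase (toℕ i)))
    spaced-phases

periodic-packing : ∀ {t ℓ k} → 2 ≤ ℓ → ℓ ≤ 4 → (∀ (i : Fin t) → rowBound (phase (toℕ i)) ≤ k) →
                   PackingColorable (PathK4 t ℓ) k
periodic-packing 2≤ℓ ℓ≤4 = Periodic.packingColouring 2≤ℓ (template-admissible 2≤ℓ ℓ≤4)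

copy-needs-4 : ∀ {t ℓ k} → PackingColoring (PathK4 (suc t) ℓ) k → 4 ≤ k
copy-needs-4 {ℓ = ℓ} {k} K = injective⇒≤ index-injective
  where
  open PackingColoring K
  index : Fin 4 → Fin k
  index a = colourIndex K ≤-refl (zero , a)
  index-injective : ∀ {a b} → index a ≡ index b → a ≡ b
  index-injective {a} {b} same = decidable-stable (a ≟ᶠ b) λ a≢b →
    colour-clash K (a≢b ∘ proj₂ ∘ ,-injective) (within-copy {ℓ = ℓ} zero a b) (col-pos _)
      (colourIndex-injective K ≤-refl same)

bridge-within-3 : ∀ {t ℓ} {i j : Fin t} {e} a b → toℕ j ≡ suc (toℕ i) → toℕ e ≡ ℓ ∸ 1 →
                  Within (PathK4 t ℓ) (i , a) (j , b) 3
bridge-within-3 {ℓ = ℓ} {i} {j} {e} a b j≡1+i e≡exit =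
  Within-++ (within-copy {ℓ = ℓ} i a e)
            (step (inj₂ (inj₁ (j≡1+i , e≡exit , refl))) (within-copy {ℓ = ℓ} j zero b))

-- The seven places a colour can take in the first two copies: colours 1 and 2
-- once per copy, every other colour once in both together.
slot : Fin 5 → Fin 2 → Fin 7
slot 0F 0F = 0F
slot 0F 1F = 1F
slot 1F 0F = 2F
slot 1F 1F = 3F
slot 2F _  = 4F
slot 3F _  = 5F
slot 4F _  = 6F

slot-collision : ∀ c i d j → slot c i ≡ slot d j → c ≡ d × (i ≡ j ⊎ 2 ≤ toℕ c)
slot-collision = from-yes (all? λ c → all? λ i → all? λ d → all? λ j →
  (slot c i ≟ᶠ slot d j) →-dec ((c ≟ᶠ d) ×-dec ((i ≟ᶠ j) ⊎-dec (2 ≤? toℕ c))))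

remQuot-injective : ∀ {m} n {x y : Fin (m * n)} → remQuot {m} n x ≡ remQuot n y → x ≡ y
remQuot-injective {m} n {x} {y} eq = begin
  x                                 ≡⟨ combine-remQuot {m} n x ⟨
  uncurry combine (remQuot {m} n x) ≡⟨ cong (uncurry combine) eq ⟩
  uncurry combine (remQuot {m} n y) ≡⟨ combine-remQuot {m} n y ⟩
  y                                 ∎
  where open ≡-Reasoning

two-copies-need-6 : ∀ {t ℓ k} → ℓ ≤ 4 → PackingColoring (PathK4 (2 + t) ℓ) k → 6 ≤ k
two-copies-need-6 {t} {ℓ} {k} ℓ≤4 K =
  ≮⇒≥ λ k<6 → let k≤5 = s≤s⁻¹ k<6 in
  <-irrefl refl (injective⇒≤ {f = slotOf k≤5 ∘ remQuot {2} 4}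
                               (remQuot-injective {2} 4 ∘ slotOf-injective k≤5))
  where
  open PackingColoring K
  G = PathK4 (2 + t) ℓ

  vertex : Fin 2 × Fin 4 → V G
  vertex (i , a) = i ↑ˡ t , a

  vertex-injective : ∀ {x y} → vertex x ≡ vertex y → x ≡ y
  vertex-injective {i , _} {j , _} eq with i↑≡j↑ , a≡b ← ,-injective eq =
    cong₂ _,_ (↑ˡ-injective t i j i↑≡j↑) a≡b

  exit : Fin 4
  exit = fromℕ< (s≤s (∸-monoˡ-≤ 1 ℓ≤4))

  within-3 : ∀ i a j b → Within G (vertex (i , a)) (vertex (j , b)) 3
  within-3 0F a 0F b = Within-weaken (within-copy {ℓ = ℓ} _ a b) (s≤s z≤n)
  within-3 1F a 1F b = Within-weaken (within-copy {ℓ = ℓ} _ a b) (s≤s z≤n)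
  within-3 0F a 1F b = bridge-within-3 {ℓ = ℓ} {e = exit} a b refl (toℕ-fromℕ< _)
  within-3 1F a 0F b =
    Within-reverse (PathK4-sym {ℓ = ℓ}) (bridge-within-3 {ℓ = ℓ} {e = exit} b a refl (toℕ-fromℕ< _))

  slotOf : k ≤ 5 → Fin 2 × Fin 4 → Fin 7
  slotOf k≤5 (i , a) = slot (colourIndex K k≤5 (vertex (i , a))) i

  slotOf-injective : ∀ k≤5 {x y} → slotOf k≤5 x ≡ slotOf k≤5 y → x ≡ y
  slotOf-injective k≤5 {i , a} {j , b} eq with slot-collision _ i _ j eq
  ... | c≡d , inj₁ refl = cong (i ,_) (decidable-stable (a ≟ᶠ b) λ a≢b →
    colour-clash K (a≢b ∘ proj₂ ∘ ,-injective) (within-copy {ℓ = ℓ} _ a b) (col-pos _)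
      (colourIndex-injective K k≤5 c≡d))
  ... | c≡d , inj₂ 2≤c = decidable-stable (≡-dec _≟ᶠ_ _≟ᶠ_ (i , a) (j , b)) λ x≢y →
    colour-clash K (x≢y ∘ vertex-injective) (within-3 i a j b)
      (subst (3 ≤_) (suc-colourIndex K k≤5 _) (s≤s 2≤c)) (colourIndex-injective K k≤5 c≡d)

copies-bounded? : ∀ t k → Dec (∀ (i : Fin t) → rowBound (phase (toℕ i)) ≤ k)
copies-bounded? t k = all? λ i → rowBound (phase (toℕ i)) ≤? k

theorem15 : (t ℓ : ℕ) → 1 ≤ t → 2 ≤ ℓ → ℓ ≤ 4 →
    (t ≡ 1 → χp≡ (PathK4 t ℓ) 4)
    × ((t ≡ 2 ⊎ t ≡ 3) → χp≡ (PathK4 t ℓ) 6)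
    × (4 ≤ t → PackingColorable (PathK4 t ℓ) 8)
theorem15 t ℓ _ 2≤ℓ ℓ≤4 =
    (λ { refl → colouring (from-yes (copies-bounded? 1 4)) , lower-4 })
  , (λ { (inj₁ refl) → colouring (from-yes (copies-bounded? 2 6)) , lower-6
       ; (inj₂ refl) → colouring (from-yes (copies-bounded? 3 6)) , lower-6 })
  , λ _ → colouring (λ i → rowBound≤8 (phase (toℕ i)))
  where
  colouring : ∀ {t k} → (∀ (i : Fin t) → rowBound (phase (toℕ i)) ≤ k) →
              PackingColorable (PathK4 t ℓ) k
  colouring = periodic-packing 2≤ℓ ℓ≤4
  lower-4 : ∀ j → j < 4 → ¬ PackingColorable (PathK4 1 ℓ) j
  lower-4 j j<4 K = <⇒≱ j<4 (copy-needs-4 {ℓ = ℓ} K)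
  lower-6 : ∀ {t} j → j < 6 → ¬ PackingColorable (PathK4 (2 + t) ℓ) j
  lower-6 j j<6 K = <⇒≱ j<6 (two-copies-need-6 ℓ≤4 K)
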